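{- Let $G$ be a finite simple graph and let $T$ be a minimum twin cover of $G$, with image $\widetilde T = \{[x]: x\in T\}$ in the quotient graph $\widetilde G$. Among all determining sets for $\widetilde G$ that contain $\widetilde T$, let $\widetilde S$ be one of minimum size. Let \[ S = T \cup \{x \in V(G) \mid [x] \in \widetilde S \setminus \widetilde T\}. \] Then $S$ is a minimum size determining set for $G$. In particular, if $\widetilde S = \widetilde T$, then $T$ is a minimum size determining set for $G$.
   Context: Two vertices are twins if they have the same open neighborhood. Define $x \sim y$ if $x = y$ or $x,y$ are twins; this is an equivalence relation with classes $[x]$. The quotient graph $\widetilde G$ has the equivalence classes as vertices, with $[x]$ adjacent to $[z]$ iff $x$ is adjacent to $z$ in $G$. A minimum twin cover of $G$ is a minimum size subset of $V(G)$ containing at least one vertex from every pair of twin vertices. A set $S$ of vertices of a graph $H$ is a determining set if the only automorphism of $H$ fixing every vertex of $S$ is the identity. -}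

module Defs where

open import Data.Nat using (ℕ; _≤_)
open import Data.Bool using (Bool; true; false)
open import Data.Fin using (Fin; _≟_)
open import Data.Fin.Properties using (any?)
open import Data.Fin.Subset using (Subset; _∈_; _∪_; _─_; ∣_∣)
open import Data.Fin.Subset.Properties using (_∈?_)
open import Data.Fin.Permutation using (Permutation′; _⟨$⟩ʳ_)
open import Data.Vec using (tabulate; lookup)
open import Data.Product using (Σ; ∃; _×_; _,_)
open import Data.Sum using (_⊎_)
open import Relation.Nullary using (¬_)
open import Relation.Nullary.Decidable using (⌊_⌋; _×-dec_)
open import Relation.Binary.PropositionalEquality using (_≡_)
open import Function.Bundles using (_⇔_)

record Graph (n : ℕ) : Set where
  field
    adj    : Fin n → Fin n → Bool
    sym    : ∀ x y → adj x y ≡ adj y x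
    irrefl : ∀ x → adj x x ≡ false
open Graph public

module _ {n : ℕ} (G : Graph n) where

  Twins : Fin n → Fin n → Set
  Twins x y = ¬ (x ≡ y) × (∀ z → adj G x z ≡ adj G y z)

  TwinEquiv : Fin n → Fin n → Set
  TwinEquiv x y = x ≡ y ⊎ Twins x y

  IsTwinCover : Subset n → Set
  IsTwinCover T = ∀ x y → Twins x y → x ∈ T ⊎ y ∈ T

  IsMinTwinCover : Subset n → Set
  IsMinTwinCover T = IsTwinCover T × (∀ T′ → IsTwinCover T′ → ∣ T ∣ ≤ ∣ T′ ∣)

  IsAutomorphism : Permutation′ n → Set
  IsAutomorphism σ = ∀ x y → adj G (σ ⟨$⟩ʳ x) (σ ⟨$⟩ʳ y) ≡ adj G x y

  IsDetermining : Subset n → Set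
  IsDetermining S = ∀ σ → IsAutomorphism σ →
    (∀ x → x ∈ S → σ ⟨$⟩ʳ x ≡ x) → ∀ x → σ ⟨$⟩ʳ x ≡ x

  IsMinDetermining : Subset n → Set
  IsMinDetermining S = IsDetermining S × (∀ R → IsDetermining R → ∣ S ∣ ≤ ∣ R ∣)

record IsTwinQuotient {n m : ℕ} (G : Graph n) (H : Graph m) (q : Fin n → Fin m) : Set where
  field
    surj   : ∀ j → ∃ λ x → q x ≡ j
    classes : ∀ x y → (q x ≡ q y) ⇔ TwinEquiv G x y
    adjq   : ∀ x z → adj H (q x) (q z) ≡ adj G x z

image : {n m : ℕ} → (Fin n → Fin m) → Subset n → Subset m
image q T = tabulate λ j → ⌊ any? (λ y → (y ∈? T) ×-dec (q y ≟ j)) ⌋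

preimage : {n m : ℕ} → (Fin n → Fin m) → Subset m → Subset n
preimage q R = tabulate λ x → lookup R (q x)

liftSet : {n m : ℕ} → (Fin n → Fin m) → Subset n → Subset m → Subset n
liftSet q T S̃ = T ∪ preimage q (S̃ ─ image q T)

module Submission where

-- A minimum twin cover T misses exactly one vertex of each twin class, so q is
-- a bijection from the complement of T onto the quotient. Automorphisms of G
-- permute twin classes and thus induce automorphisms of the quotient;
-- conversely an automorphism of the quotient fixing the image of T lifts,
-- through this bijection, to an automorphism of G fixing T. The first
-- correspondence shows that S is determining. For minimality, a determining set
-- R of G must be a twin cover (else the transposition of two twins outside R
-- fixes R), and the second correspondence shows that q R ∪ q T determines the
-- quotient; counting vertices outside T then gives
-- ∣ S ∣ ≤ ∣ T ∣ + ∣ S̃ ─ q T ∣ ≤ ∣ T ∣ + ∣ (q R ∪ q T) ─ q T ∣ ≤ ∣ R ∣.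

open import Data.Bool.Properties using (T-≡) renaming (_≟_ to _≟ᵇ_)
open import Data.Empty using (⊥-elim)
open import Data.Fin using (Fin; _≟_) renaming (zero to fzero; suc to fsuc)
open import Data.Fin.Permutation
  using (Permutation′; _⟨$⟩ʳ_; _⟨$⟩ˡ_; permutation; inverseˡ; inverseʳ; flip; transpose)
import Data.Fin.Permutation.Components as Components
open import Data.Fin.Properties using (any?; all?; suc-injective; 0≢1+n)
open import Data.Fin.Subset
  using (Subset; _⊆_; ∣_∣; _∈_; _∉_; _∪_; _─_; _-_; ∁; ⊤; inside; outside)
open import Data.Fin.Subset.Properties
  using ( _∈?_; x∈p⇒∣p-x∣<∣p∣; x∈p∧x∉q⇒x∈p─q; x∈⁅y⁆⇒x≡y; x∈p∪q⁺; x∈p∪q⁻; q⊆p∪q; p─q⊆p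
        ; x∉p⇒x∈∁p; x∈∁p⇒x∉p; ∣⊤∣≡n; ∣p∣≤n; ∣∁p∣≡n∸∣p∣; ⊆-antisym; drop-∷-⊆)
open import Data.Nat using (ℕ; _≤_; _+_; suc; z≤n; s≤s)
open import Data.Nat.Properties
  using (≤-trans; +-suc; m≤n⇒m≤1+n; m+[n∸m]≡n; +-assoc; <⇒≱; +-monoʳ-≤; +-cancelʳ-≤; module ≤-Reasoning)
open import Data.Product using (∃; _×_; _,_; proj₁; proj₂)
open import Data.Sum using (_⊎_; inj₁; inj₂)
open import Data.Vec using (_∷_; []; here; there; lookup)
open import Data.Vec.Properties using (lookup∘tabulate; lookup⇒[]=; []=⇒lookup)
open import Defs hiding (sym)
open import Function using (_∘_)
open import Function.Bundles using (Equivalence)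
open import Relation.Binary.PropositionalEquality
open import Relation.Nullary using (¬_; Dec; yes; no; ¬?)
open import Relation.Nullary.Decidable using (_×-dec_; dec-true; isYes≗does; toWitness)

private
  variable
    n m : ℕ

x∈p─q⇒x∉q : ∀ {x : Fin n} (p q : Subset n) → x ∈ p ─ q → x ∉ q
x∈p─q⇒x∉q (_ ∷ p) (_ ∷ q) (there x∈) (there x∈q) = x∈p─q⇒x∉q p q x∈ x∈q

∣p∪q∣≤∣p∣+∣q∣ : ∀ (p q : Subset n) → ∣ p ∪ q ∣ ≤ ∣ p ∣ + ∣ q ∣
∣p∪q∣≤∣p∣+∣q∣ [] [] = z≤n
∣p∪q∣≤∣p∣+∣q∣ (outside ∷ p) (outside ∷ q) = ∣p∪q∣≤∣p∣+∣q∣ p q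
∣p∪q∣≤∣p∣+∣q∣ (outside ∷ p) (inside ∷ q) =
  subst (suc ∣ p ∪ q ∣ ≤_) (sym (+-suc ∣ p ∣ ∣ q ∣)) (s≤s (∣p∪q∣≤∣p∣+∣q∣ p q))
∣p∪q∣≤∣p∣+∣q∣ (inside ∷ p) (outside ∷ q) = s≤s (∣p∪q∣≤∣p∣+∣q∣ p q)
∣p∪q∣≤∣p∣+∣q∣ (inside ∷ p) (inside ∷ q) =
  s≤s (subst (∣ p ∪ q ∣ ≤_) (sym (+-suc ∣ p ∣ ∣ q ∣)) (m≤n⇒m≤1+n (∣p∪q∣≤∣p∣+∣q∣ p q)))

∣p∣+∣∁p∣≡n : ∀ (p : Subset n) → ∣ p ∣ + ∣ ∁ p ∣ ≡ n
∣p∣+∣∁p∣≡n p = trans (cong (∣ p ∣ +_) (∣∁p∣≡n∸∣p∣ p)) (m+[n∸m]≡n (∣p∣≤n p))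

q⊆p⇒∣p∣≡∣p─q∣+∣q∣ : ∀ (p q : Subset n) → q ⊆ p → ∣ p ∣ ≡ ∣ p ─ q ∣ + ∣ q ∣
q⊆p⇒∣p∣≡∣p─q∣+∣q∣ [] [] _ = refl
q⊆p⇒∣p∣≡∣p─q∣+∣q∣ (_ ∷ p) (outside ∷ q) q⊆p with q⊆p⇒∣p∣≡∣p─q∣+∣q∣ p q (drop-∷-⊆ q⊆p)
q⊆p⇒∣p∣≡∣p─q∣+∣q∣ (outside ∷ p) (outside ∷ q) q⊆p | eq = eq
q⊆p⇒∣p∣≡∣p─q∣+∣q∣ (inside ∷ p) (outside ∷ q) q⊆p | eq = cong suc eq
q⊆p⇒∣p∣≡∣p─q∣+∣q∣ (outside ∷ p) (inside ∷ q) q⊆p with () ← q⊆p here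
q⊆p⇒∣p∣≡∣p─q∣+∣q∣ (inside ∷ p) (inside ∷ q) q⊆p =
  trans (cong suc (q⊆p⇒∣p∣≡∣p─q∣+∣q∣ p q (drop-∷-⊆ q⊆p))) (sym (+-suc _ _))

∣p─r∣≤∣q─r∣ : ∀ (p q r : Subset n) → r ⊆ p → r ⊆ q → ∣ p ∣ ≤ ∣ q ∣ → ∣ p ─ r ∣ ≤ ∣ q ─ r ∣
∣p─r∣≤∣q─r∣ p q r r⊆p r⊆q ∣p∣≤∣q∣ = +-cancelʳ-≤ ∣ r ∣ _ _
  (subst₂ _≤_ (q⊆p⇒∣p∣≡∣p─q∣+∣q∣ p r r⊆p) (q⊆p⇒∣p∣≡∣p─q∣+∣q∣ q r r⊆q) ∣p∣≤∣q∣)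

injectiveOn⇒∣p∣≤∣q∣ : ∀ (f : Fin n → Fin m) (p : Subset n) (q : Subset m) →
  (∀ {x} → x ∈ p → f x ∈ q) →
  (∀ {x y} → x ∈ p → y ∈ p → f x ≡ f y → x ≡ y) → ∣ p ∣ ≤ ∣ q ∣
injectiveOn⇒∣p∣≤∣q∣ f [] q maps inj = z≤n
injectiveOn⇒∣p∣≤∣q∣ f (outside ∷ p) q maps inj =
  injectiveOn⇒∣p∣≤∣q∣ (f ∘ fsuc) p q (maps ∘ there)
    (λ x∈ y∈ e → suc-injective (inj (there x∈) (there y∈) e))
injectiveOn⇒∣p∣≤∣q∣ f (inside ∷ p) q maps inj =
  ≤-trans (s≤s (injectiveOn⇒∣p∣≤∣q∣ (f ∘ fsuc) p (q - f fzero) maps-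
                 (λ x∈ y∈ e → suc-injective (inj (there x∈) (there y∈) e))))
          (x∈p⇒∣p-x∣<∣p∣ (maps here))
  where
  maps- : ∀ {x} → x ∈ p → f (fsuc x) ∈ q - f fzero
  maps- x∈ = x∈p∧x∉q⇒x∈p─q (maps (there x∈))
    (λ e → 0≢1+n (inj here (there x∈) (sym (x∈⁅y⁆⇒x≡y _ e))))

module _ (f : Fin n → Fin m) where

  ∈image⁺ : ∀ {p : Subset n} {x j} → x ∈ p → f x ≡ j → j ∈ image f p
  ∈image⁺ {p} {x} {j} x∈p fx≡j = lookup⇒[]= j _
    (trans (lookup∘tabulate _ j) (trans (isYes≗does found?) (dec-true found? (x , x∈p , fx≡j))))
    where found? = any? (λ y → (y ∈? p) ×-dec (f y ≟ j))

  ∈image⁻ : ∀ {p : Subset n} {j} → j ∈ image f p → ∃ λ x → x ∈ p × f x ≡ j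
  ∈image⁻ {p} {j} j∈ = toWitness {a? = any? (λ y → (y ∈? p) ×-dec (f y ≟ j))}
    (Equivalence.from T-≡ (trans (sym (lookup∘tabulate _ j)) ([]=⇒lookup j∈)))

  ∈preimage⁺ : ∀ {r : Subset m} {x} → f x ∈ r → x ∈ preimage f r
  ∈preimage⁺ {r} {x} fx∈ = lookup⇒[]= x _ (trans (lookup∘tabulate _ x) ([]=⇒lookup fx∈))

  ∈preimage⁻ : ∀ {r : Subset m} {x} → x ∈ preimage f r → f x ∈ r
  ∈preimage⁻ {r} {x} x∈ = lookup⇒[]= (f x) r
    (trans (sym (lookup∘tabulate (λ y → lookup r (f y)) x)) ([]=⇒lookup x∈))

⟨$⟩ʳ-injective : ∀ (σ : Permutation′ n) {x y} → σ ⟨$⟩ʳ x ≡ σ ⟨$⟩ʳ y → x ≡ y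
⟨$⟩ʳ-injective σ e = trans (sym (inverseˡ σ)) (trans (cong (σ ⟨$⟩ˡ_) e) (inverseˡ σ))

module _ (G : Graph n) where

  twins? : ∀ x y → Dec (Twins G x y)
  twins? x y = ¬? (x ≟ y) ×-dec all? (λ z → adj G x z ≟ᵇ adj G y z)

  twins-sym : ∀ {x y} → Twins G x y → Twins G y x
  twins-sym (x≢y , same) = x≢y ∘ sym , sym ∘ same

  flip-automorphism : ∀ σ → IsAutomorphism G σ → IsAutomorphism G (flip σ)
  flip-automorphism σ aut x y =
    trans (sym (aut (flip σ ⟨$⟩ʳ x) (flip σ ⟨$⟩ʳ y))) (cong₂ (adj G) (inverseʳ σ) (inverseʳ σ))

  automorphism-preserves-TwinEquiv : ∀ σ → IsAutomorphism G σ →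
    ∀ {x y} → TwinEquiv G x y → TwinEquiv G (σ ⟨$⟩ʳ x) (σ ⟨$⟩ʳ y)
  automorphism-preserves-TwinEquiv σ aut (inj₁ refl) = inj₁ refl
  automorphism-preserves-TwinEquiv σ aut {x} {y} (inj₂ (x≢y , same)) =
    inj₂ (x≢y ∘ ⟨$⟩ʳ-injective σ , same′)
    where
    open ≡-Reasoning
    same′ : ∀ w → adj G (σ ⟨$⟩ʳ x) w ≡ adj G (σ ⟨$⟩ʳ y) w
    same′ w = begin
      adj G (σ ⟨$⟩ʳ x) w                 ≡⟨ cong (adj G _) (inverseʳ σ) ⟨
      adj G (σ ⟨$⟩ʳ x) (σ ⟨$⟩ʳ (σ ⟨$⟩ˡ w)) ≡⟨ aut x _ ⟩
      adj G x (σ ⟨$⟩ˡ w)                 ≡⟨ same _ ⟩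
      adj G y (σ ⟨$⟩ˡ w)                 ≡⟨ aut y _ ⟨
      adj G (σ ⟨$⟩ʳ y) (σ ⟨$⟩ʳ (σ ⟨$⟩ˡ w)) ≡⟨ cong (adj G _) (inverseʳ σ) ⟩
      adj G (σ ⟨$⟩ʳ y) w                 ∎

  transpose-twins-automorphism : ∀ {x y} → Twins G x y → IsAutomorphism G (transpose x y)
  transpose-twins-automorphism {x} {y} (_ , same) a b =
    trans (swap-adj a (swap b)) (trans (Graph.sym G a (swap b)) (trans (swap-adj b a) (Graph.sym G b a)))
    where
    swap = Components.transpose x y
    swap-adj : ∀ k w → adj G (swap k) w ≡ adj G k w
    swap-adj k w with k ≟ x
    ... | yes refl = sym (same w)
    ... | no _ with k ≟ y
    ...   | yes refl = same w
    ...   | no _ = refl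

  determining⇒twinCover : ∀ {R} → IsDetermining G R → IsTwinCover G R
  determining⇒twinCover {R} det x y tw with x ∈? R | y ∈? R
  ... | yes x∈R | _ = inj₁ x∈R
  ... | no _ | yes y∈R = inj₂ y∈R
  ... | no x∉R | no y∉R =
    ⊥-elim (proj₁ tw (trans (sym (det (transpose x y) (transpose-twins-automorphism tw) fixes x)) swap-x))
    where
    swap = Components.transpose x y
    swap-x : swap x ≡ y
    swap-x with x ≟ x
    ... | yes _ = refl
    ... | no x≢x = ⊥-elim (x≢x refl)
    fixes : ∀ z → z ∈ R → swap z ≡ z
    fixes z z∈R with z ≟ x
    ... | yes refl = ⊥-elim (x∉R z∈R)
    ... | no _ with z ≟ y
    ...   | yes refl = ⊥-elim (y∉R z∈R)
    ...   | no _ = refl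

  -- Otherwise T - x would be a smaller twin cover.
  minTwinCover-twin-outside : ∀ {T x} → IsMinTwinCover G T → x ∈ T → ∃ λ y → y ∉ T × Twins G x y
  minTwinCover-twin-outside {T} {x} (cover , minimal) x∈T
    with any? (λ y → ¬? (y ∈? T) ×-dec twins? x y)
  ... | yes witness = witness
  ... | no none = ⊥-elim (<⇒≱ (x∈p⇒∣p-x∣<∣p∣ x∈T) (minimal (T - x) cover-x))
    where
    ∈T-x : ∀ {a} → a ∈ T → ¬ a ≡ x → a ∈ T - x
    ∈T-x a∈T a≢x = x∈p∧x∉q⇒x∈p─q a∈T (a≢x ∘ x∈⁅y⁆⇒x≡y _)
    cover-from : ∀ {a b} → a ∈ T → Twins G a b → a ∈ T - x ⊎ b ∈ T - x
    cover-from {a} {b} a∈T tw with a ≟ x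
    ... | no a≢x = inj₁ (∈T-x a∈T a≢x)
    ... | yes refl with b ∈? T
    ...   | yes b∈T = inj₂ (∈T-x b∈T (proj₁ tw ∘ sym))
    ...   | no b∉T = ⊥-elim (none (b , b∉T , tw))
    cover-x : IsTwinCover G (T - x)
    cover-x a b tw with cover a b tw
    ... | inj₁ a∈T = cover-from a∈T tw
    ... | inj₂ b∈T with cover-from b∈T (twins-sym tw)
    ...   | inj₁ b∈ = inj₂ b∈
    ...   | inj₂ a∈ = inj₁ a∈

module TwinQuotient {G : Graph n} {H : Graph m} {q : Fin n → Fin m} (Q : IsTwinQuotient G H q) where

  open IsTwinQuotient Q

  twinCover-injective : ∀ {C x y} → IsTwinCover G C → x ∉ C → y ∉ C → q x ≡ q y → x ≡ y
  twinCover-injective cover x∉C y∉C qx≡qy with Equivalence.to (classes _ _) qx≡qy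
  ... | inj₁ x≡y = x≡y
  ... | inj₂ tw with cover _ _ tw
  ...   | inj₁ x∈C = ⊥-elim (x∉C x∈C)
  ...   | inj₂ y∈C = ⊥-elim (y∉C y∈C)

  rep : Fin m → Fin n
  rep j = proj₁ (surj j)

  q-rep : ∀ j → q (rep j) ≡ j
  q-rep j = proj₂ (surj j)

  liftSet-meets : ∀ {T S̃ j} → j ∈ S̃ → ∃ λ x → x ∈ liftSet q T S̃ × q x ≡ j
  liftSet-meets {T} {S̃} {j} j∈S̃ with j ∈? image q T
  ... | yes j∈qT with ∈image⁻ q j∈qT
  ...   | x , x∈T , qx≡j = x , x∈p∪q⁺ (inj₁ x∈T) , qx≡j
  liftSet-meets {T} {S̃} {j} j∈S̃ | no j∉qT =
    rep j , x∈p∪q⁺ (inj₂ (∈preimage⁺ q (subst (_∈ S̃ ─ image q T) (sym (q-rep j)) (x∈p∧x∉q⇒x∈p─q j∈S̃ j∉qT))))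
      , q-rep j

  module Induced (σ : Permutation′ n) (aut : IsAutomorphism G σ) where

    induced : Fin m → Fin m
    induced j = q (σ ⟨$⟩ʳ rep j)

    induced-q : ∀ x → induced (q x) ≡ q (σ ⟨$⟩ʳ x)
    induced-q x = Equivalence.from (classes _ _)
      (automorphism-preserves-TwinEquiv G σ aut (Equivalence.to (classes _ _) (q-rep (q x))))

    induced-automorphism : ∀ j k → adj H (induced j) (induced k) ≡ adj H j k
    induced-automorphism j k = begin
      adj H (induced j) (induced k)   ≡⟨ adjq _ _ ⟩
      adj G (σ ⟨$⟩ʳ rep j) (σ ⟨$⟩ʳ rep k) ≡⟨ aut _ _ ⟩
      adj G (rep j) (rep k)           ≡⟨ adjq _ _ ⟨
      adj H (q (rep j)) (q (rep k))   ≡⟨ cong₂ (adj H) (q-rep j) (q-rep k) ⟩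
      adj H j k                       ∎
      where open ≡-Reasoning

  inducedPermutation : ∀ σ → IsAutomorphism G σ → Permutation′ m
  inducedPermutation σ aut = permutation (induced σ aut) (induced (flip σ) (flip-automorphism G σ aut))
    (λ j → trans (induced-q σ aut _) (trans (cong q (inverseʳ σ)) (q-rep j)))
    (λ j → trans (induced-q (flip σ) (flip-automorphism G σ aut) _) (trans (cong q (inverseˡ σ)) (q-rep j)))
    where open Induced

  module _ {T : Subset n} (cover : IsTwinCover G T) where

    liftSet-determining : ∀ {S̃} → IsDetermining H S̃ → IsDetermining G (liftSet q T S̃)
    liftSet-determining {S̃} detH σ aut fixes = fixes-all
      where
      open Induced σ aut
      τ = inducedPermutation σ aut

      τ-fixes : ∀ j → j ∈ S̃ → τ ⟨$⟩ʳ j ≡ j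
      τ-fixes j j∈S̃ with liftSet-meets j∈S̃
      ... | x , x∈S , refl = trans (induced-q x) (cong q (fixes x x∈S))

      σ-preserves-classes : ∀ x → q (σ ⟨$⟩ʳ x) ≡ q x
      σ-preserves-classes x = trans (sym (induced-q x)) (detH τ induced-automorphism τ-fixes (q x))

      fixes-all : ∀ x → σ ⟨$⟩ʳ x ≡ x
      fixes-all x with x ∈? T | σ ⟨$⟩ʳ x ∈? T
      ... | yes x∈T | _ = fixes x (x∈p∪q⁺ (inj₁ x∈T))
      ... | no _ | yes σx∈T = ⟨$⟩ʳ-injective σ (fixes _ (x∈p∪q⁺ (inj₁ σx∈T)))
      ... | no x∉T | no σx∉T = twinCover-injective cover σx∉T x∉T (σ-preserves-classes x)

    ∣liftSet∣≤ : ∀ S̃ → ∣ liftSet q T S̃ ∣ ≤ ∣ T ∣ + ∣ S̃ ─ image q T ∣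
    ∣liftSet∣≤ S̃ = ≤-trans (∣p∪q∣≤∣p∣+∣q∣ T P) (+-monoʳ-≤ ∣ T ∣
      (injectiveOn⇒∣p∣≤∣q∣ q P (S̃ ─ image q T) (∈preimage⁻ q)
        (λ x∈ y∈ → twinCover-injective cover (P∌T x∈) (P∌T y∈))))
      where
      P = preimage q (S̃ ─ image q T)
      P∌T : ∀ {x} → x ∈ P → x ∉ T
      P∌T x∈P x∈T = x∈p─q⇒x∉q S̃ (image q T) (∈preimage⁻ q x∈P) (∈image⁺ q x∈T refl)

    liftSet-image : liftSet q T (image q T) ≡ T
    liftSet-image = ⊆-antisym ⊆T (λ x∈T → x∈p∪q⁺ (inj₁ x∈T))
      where
      ⊆T : liftSet q T (image q T) ⊆ T
      ⊆T x∈ with x∈p∪q⁻ T _ x∈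
      ... | inj₁ x∈T = x∈T
      ... | inj₂ x∈P with ∈preimage⁻ q x∈P
      ...   | qx∈ = ⊥-elim (x∈p─q⇒x∉q (image q T) (image q T) qx∈ (p─q⊆p _ _ qx∈))

  module _ {T : Subset n} (minT : IsMinTwinCover G T) where

    private
      cover = proj₁ minT

      representative : ∀ j → ∃ λ x → x ∉ T × q x ≡ j
      representative j with rep j ∈? T
      ... | no rep∉T = rep j , rep∉T , q-rep j
      ... | yes rep∈T with minTwinCover-twin-outside G minT rep∈T
      ...   | y , y∉T , tw = y , y∉T , trans (sym (Equivalence.from (classes _ _) (inj₂ tw))) (q-rep j)

    rep′ : Fin m → Fin n
    rep′ j = proj₁ (representative j)

    rep′∉T : ∀ j → rep′ j ∉ T
    rep′∉T j = proj₁ (proj₂ (representative j))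

    q-rep′ : ∀ j → q (rep′ j) ≡ j
    q-rep′ j = proj₂ (proj₂ (representative j))

    rep′-q : ∀ {x} → x ∉ T → rep′ (q x) ≡ x
    rep′-q x∉T = twinCover-injective cover (rep′∉T _) x∉T (q-rep′ _)

    liftMap : (Fin m → Fin m) → Fin n → Fin n
    liftMap f x with x ∈? T
    ... | yes _ = x
    ... | no _ = rep′ (f (q x))

    liftMap-∈ : ∀ f {x} → x ∈ T → liftMap f x ≡ x
    liftMap-∈ f {x} x∈T with x ∈? T
    ... | yes _ = refl
    ... | no x∉T = ⊥-elim (x∉T x∈T)

    liftMap-∉ : ∀ f {x} → x ∉ T → liftMap f x ≡ rep′ (f (q x))
    liftMap-∉ f {x} x∉T with x ∈? T
    ... | yes x∈T = ⊥-elim (x∉T x∈T)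
    ... | no _ = refl

    q-liftMap : ∀ f → (∀ j → j ∈ image q T → f j ≡ j) → ∀ x → q (liftMap f x) ≡ f (q x)
    q-liftMap f fixes x with x ∈? T
    ... | yes x∈T = sym (fixes _ (∈image⁺ q x∈T refl))
    ... | no _ = q-rep′ _

    liftMap-inverse : ∀ f g → (∀ j → f (g j) ≡ j) → ∀ x → liftMap f (liftMap g x) ≡ x
    liftMap-inverse f g fg x with x ∈? T
    ... | yes x∈T = liftMap-∈ f x∈T
    ... | no x∉T = begin
      liftMap f (rep′ (g (q x)))  ≡⟨ liftMap-∉ f (rep′∉T _) ⟩
      rep′ (f (q (rep′ (g (q x))))) ≡⟨ cong (rep′ ∘ f) (q-rep′ _) ⟩
      rep′ (f (g (q x)))          ≡⟨ cong rep′ (fg _) ⟩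
      rep′ (q x)                  ≡⟨ rep′-q x∉T ⟩
      x                           ∎
      where open ≡-Reasoning

    image-determining : ∀ {R} → IsDetermining G R → IsDetermining H (image q R ∪ image q T)
    image-determining {R} detG τ aut fixes j = begin
      τ ⟨$⟩ʳ j               ≡⟨ cong (τ ⟨$⟩ʳ_) (q-rep′ j) ⟨
      τ ⟨$⟩ʳ q (rep′ j)      ≡⟨ q-liftMap t fixes-qT (rep′ j) ⟨
      q (liftMap t (rep′ j)) ≡⟨ cong q (detG σ σ-automorphism σ-fixes (rep′ j)) ⟩
      q (rep′ j)             ≡⟨ q-rep′ j ⟩
      j                      ∎
      where
      open ≡-Reasoning
      t = τ ⟨$⟩ʳ_
      fixes-qT : ∀ j → j ∈ image q T → t j ≡ j
      fixes-qT j j∈ = fixes j (x∈p∪q⁺ (inj₂ j∈))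
      σ : Permutation′ n
      σ = permutation (liftMap t) (liftMap (τ ⟨$⟩ˡ_))
        (liftMap-inverse _ _ (λ _ → inverseʳ τ)) (liftMap-inverse _ _ (λ _ → inverseˡ τ))
      σ-automorphism : IsAutomorphism G σ
      σ-automorphism x y = trans (sym (adjq _ _))
        (trans (cong₂ (adj H) (q-liftMap t fixes-qT x) (q-liftMap t fixes-qT y))
               (trans (aut _ _) (adjq x y)))
      σ-fixes : ∀ x → x ∈ R → σ ⟨$⟩ʳ x ≡ x
      σ-fixes x x∈R with x ∈? T
      ... | yes _ = refl
      ... | no x∉T = trans (cong rep′ (fixes _ (x∈p∪q⁺ (inj₁ (∈image⁺ q x∈R refl))))) (rep′-q x∉T)

    -- Count the complement: q maps ∁ R injectively into the classes outside
    -- (image q R ∪ image q T) ─ image q T, and rep′ maps all classes into ∁ T.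
    ≤∣determining∣ : ∀ {R} → IsDetermining G R → ∣ T ∣ + ∣ (image q R ∪ image q T) ─ image q T ∣ ≤ ∣ R ∣
    ≤∣determining∣ {R} detG = +-cancelʳ-≤ ∣ ∁ R ∣ _ _ (begin
      ∣ T ∣ + ∣ X ∣ + ∣ ∁ R ∣   ≡⟨ +-assoc ∣ T ∣ _ _ ⟩
      ∣ T ∣ + (∣ X ∣ + ∣ ∁ R ∣) ≤⟨ +-monoʳ-≤ ∣ T ∣ (+-monoʳ-≤ ∣ X ∣ ∣∁R∣≤∣∁X∣) ⟩
      ∣ T ∣ + (∣ X ∣ + ∣ ∁ X ∣) ≡⟨ cong (∣ T ∣ +_) (∣p∣+∣∁p∣≡n X) ⟩
      ∣ T ∣ + m                 ≤⟨ +-monoʳ-≤ ∣ T ∣ m≤∣∁T∣ ⟩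
      ∣ T ∣ + ∣ ∁ T ∣           ≡⟨ ∣p∣+∣∁p∣≡n T ⟩
      n                         ≡⟨ ∣p∣+∣∁p∣≡n R ⟨
      ∣ R ∣ + ∣ ∁ R ∣           ∎)
      where
      open ≤-Reasoning
      X = (image q R ∪ image q T) ─ image q T

      qx∈X⇒x∈R : ∀ {x} → q x ∈ X → x ∈ R
      qx∈X⇒x∈R {x} qx∈X = from-∪ (x∈p∪q⁻ (image q R) (image q T) (p─q⊆p _ _ qx∈X))
        where
        qx∉qT : q x ∉ image q T
        qx∉qT = x∈p─q⇒x∉q _ (image q T) qx∈X
        from-∪ : q x ∈ image q R ⊎ q x ∈ image q T → x ∈ R
        from-∪ (inj₂ qx∈qT) = ⊥-elim (qx∉qT qx∈qT)
        from-∪ (inj₁ qx∈qR) with ∈image⁻ q qx∈qR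
        ... | y , y∈R , qy≡qx = subst (_∈ R) y≡x y∈R
          where
          y≡x = twinCover-injective cover (qx∉qT ∘ λ y∈T → ∈image⁺ q y∈T qy≡qx)
                                          (qx∉qT ∘ λ x∈T → ∈image⁺ q x∈T refl) qy≡qx

      ∁R⇒∁X : ∀ {x} → x ∈ ∁ R → q x ∈ ∁ X
      ∁R⇒∁X x∈∁R = x∉p⇒x∈∁p (x∈∁p⇒x∉p x∈∁R ∘ qx∈X⇒x∈R)

      ∣∁R∣≤∣∁X∣ : ∣ ∁ R ∣ ≤ ∣ ∁ X ∣
      ∣∁R∣≤∣∁X∣ = injectiveOn⇒∣p∣≤∣q∣ q (∁ R) (∁ X) ∁R⇒∁X
        (λ x∈ y∈ → twinCover-injective (determining⇒twinCover G detG) (x∈∁p⇒x∉p x∈) (x∈∁p⇒x∉p y∈))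

      m≤∣∁T∣ : m ≤ ∣ ∁ T ∣
      m≤∣∁T∣ = subst (_≤ ∣ ∁ T ∣) (∣⊤∣≡n m) (injectiveOn⇒∣p∣≤∣q∣ rep′ ⊤ (∁ T)
        (λ _ → x∉p⇒x∈∁p (rep′∉T _))
        (λ _ _ e → trans (sym (q-rep′ _)) (trans (cong q e) (q-rep′ _))))

theorem5 : {n m : ℕ} (G : Graph n) (H : Graph m) (q : Fin n → Fin m) →
    IsTwinQuotient G H q →
    (T : Subset n) → IsMinTwinCover G T →
    (S̃ : Subset m) → IsDetermining H S̃ → image q T ⊆ S̃ →
    (∀ R → IsDetermining H R → image q T ⊆ R → ∣ S̃ ∣ ≤ ∣ R ∣) →
    IsMinDetermining G (liftSet q T S̃)
    × (S̃ ≡ image q T → IsMinDetermining G T)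
theorem5 G H q Q T minT S̃ detS̃ qT⊆S̃ minS̃ =
  minS , λ { refl → subst (IsMinDetermining G) (liftSet-image cover) minS }
  where
  open TwinQuotient Q
  open ≤-Reasoning
  cover = proj₁ minT

  minS : IsMinDetermining G (liftSet q T S̃)
  minS = liftSet-determining cover detS̃ , λ R detR →
    let R̃ = image q R ∪ image q T
        qT⊆R̃ = q⊆p∪q (image q R) (image q T)
    in begin
      ∣ liftSet q T S̃ ∣          ≤⟨ ∣liftSet∣≤ cover S̃ ⟩
      ∣ T ∣ + ∣ S̃ ─ image q T ∣ ≤⟨ +-monoʳ-≤ ∣ T ∣ (∣p─r∣≤∣q─r∣ S̃ R̃ _ qT⊆S̃ qT⊆R̃
                                      (minS̃ R̃ (image-determining minT detR) qT⊆R̃)) ⟩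
      ∣ T ∣ + ∣ R̃ ─ image q T ∣  ≤⟨ ≤∣determining∣ minT detR ⟩
      ∣ R ∣                      ∎
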